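{- For $n\ge 3$ let $g_n=g_n(x_1,\dots,x_n;y)=\sum_{\sigma\in\mathfrak{S}_n}\mathbf{x}_{CP(\sigma)}\,y^{|CP(\sigma)|}$. Then $g_3 = 4+2x_3y$ and for all $n\ge 3$, $$g_{n+1} = [2+(n-1)x_{n+1}y]\,g_n + 2x_{n+1}\sum_{i=1}^n \frac{\partial g_n}{\partial x_i} - 2x_{n+1}y^2\frac{\partial g_n}{\partial y}.$$
   Context: For integers $a \le b$, $[a,b]=\{a,\dots,b\}$ and $[n]=[1,n]$. $\mathfrak{S}_n$ is the set of permutations of $[n]$, written in one-line form $\sigma=(\sigma(1)\cdots\sigma(n))$. The circular peak set of $\sigma\in\mathfrak{S}_n$ is $CP(\sigma)=\{\sigma(i) : 2\le i\le n-1,\ \sigma(i-1)<\sigma(i)>\sigma(i+1)\}$. For $S=\{i_1,\dots,i_k\}\subseteq[n]$, $\mathbf{x}_S$ denotes the monomial $x_{i_1}x_{i_2}\cdots x_{i_k}$ in commuting variables $x_1,x_2,\dots$, with $\mathbf{x}_\emptyset=1$; $y$ is a further variable. -}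

module Defs where

open import Data.Nat as ℕ using (ℕ; zero; suc; _<ᵇ_; _∸_)
open import Data.Integer as ℤ using (ℤ; +_)
open import Data.Fin using (Fin; toℕ; fromℕ; inject₁)
open import Data.Bool using (Bool; true; false; if_then_else_; _∧_)
open import Data.List as L using (List; []; _∷_; [_]; _++_; map; concatMap; filter; length; upTo)
open import Data.List.Membership.DecPropositional ℕ._≟_ using (_∈?_)
open import Data.List.Relation.Unary.Unique.DecPropositional ℕ._≟_ using (unique?)
open import Data.Vec as V using (Vec; tabulate; replicate; lookup; updateAt; _∷ʳ_)
open import Data.Vec.Properties using (≡-dec)
open import Data.Product using (_×_; _,_)
open import Relation.Nullary using (does)
open import Relation.Binary.PropositionalEquality using (_≡_)

words : ℕ → List ℕ → List (List ℕ)
words zero    A = [ [] ]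
words (suc k) A = concatMap (λ a → map (a ∷_) (words k A)) A

range : ℕ → List ℕ
range n = map suc (upTo n)

perms : ℕ → List (List ℕ)
perms n = filter (λ w → unique? w) (words n (range n))

CP : List ℕ → List ℕ
CP (a ∷ b ∷ c ∷ rest) =
  (if (a <ᵇ b) ∧ (c <ᵇ b) then (b ∷_) else (λ l → l)) (CP (b ∷ c ∷ rest))
CP _ = []

-- Polynomials in x_1,…,x_n, y over ℤ, as finite formal sums of terms
-- (coefficient , exponent vector of x_1..x_n , exponent of y).
-- Position i : Fin n of the exponent vector corresponds to x_{toℕ i + 1}.

Term : ℕ → Set
Term n = ℤ × Vec ℕ n × ℕ

Poly : ℕ → Set
Poly n = List (Term n)

coeff : ∀ {n} → Poly n → Vec ℕ n → ℕ → ℤ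
coeff []               e k = + 0
coeff ((c , e' , k') ∷ p) e k =
  (if does (≡-dec ℕ._≟_ e' e) ∧ does (k' ℕ.≟ k) then c else + 0) ℤ.+ coeff p e k

infix 4 _≈P_
_≈P_ : ∀ {n} → Poly n → Poly n → Set
p ≈P q = ∀ e k → coeff p e k ≡ coeff q e k

const : ∀ {n} → ℤ → Poly n
const c = [ (c , replicate _ 0 , 0) ]

infixl 6 _⊕_
_⊕_ : ∀ {n} → Poly n → Poly n → Poly n
_⊕_ = _++_

scale : ∀ {n} → ℤ → Poly n → Poly n
scale a = map (λ { (c , e , k) → (a ℤ.* c , e , k) })

mulY : ∀ {n} → Poly n → Poly n
mulY = map (λ { (c , e , k) → (c , e , suc k) })

mulX : ∀ {n} → Fin n → Poly n → Poly n
mulX i = map (λ { (c , e , k) → (c , updateAt e i suc , k) })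

dX : ∀ {n} → Fin n → Poly n → Poly n
dX i = map (λ { (c , e , k) → (c ℤ.* + lookup e i , updateAt e i (λ m → m ∸ 1) , k) })

dY : ∀ {n} → Poly n → Poly n
dY = map (λ { (c , e , k) → (c ℤ.* + k , e , k ∸ 1) })

lift : ∀ {n} → Poly n → Poly (suc n)
lift = map (λ { (c , e , k) → (c , e ∷ʳ 0 , k) })

sumdX : ∀ {n} → Poly n → Poly n
sumdX {n} p = concatMap (λ i → dX i p) (Data.List.allFin n)
  where import Data.List

xS : (n : ℕ) → List ℕ → Vec ℕ n
xS n S = tabulate (λ i → if does (suc (toℕ i) ∈? S) then 1 else 0)

g : (n : ℕ) → Poly n
g n = map (λ σ → (+ 1 , xS n (CP σ) , length (CP σ))) (perms n)

-- Every permutation of [n + 1] arises exactly once by inserting n + 1 into a permutation σ of [n].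
-- Inserting it at either end leaves the peak set P of σ unchanged; inserting it between neighbours
-- a and b adds the peak n + 1 and removes whichever of a, b was a peak (adjacent entries cannot both
-- be peaks). Each peak p of σ is interior, so exactly two of the n − 1 inner slots are next to it.
-- Hence the insertions into σ contribute
--   2 x^P y^k + (n − 1) x_{n+1} x^P y^{k+1} − 2 Σ_{p ∈ P} (x_{n+1} x^P y^{k+1} − x_{n+1} x^{P∖p} y^k),
-- which is the right-hand side of the recurrence applied to x^P y^k.

module Submission where

open import Defs
open import Algebra.Bundles using (CommutativeMonoid)
open import Algebra.Properties.CommutativeSemigroup using (interchange)
open import Data.Bool using (Bool; true; false; if_then_else_; _∧_)
open import Data.Bool.Properties using (∧-identityʳ; ∧-zeroʳ; T-≡; T-∧)
open import Data.Empty using (⊥-elim)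
open import Data.Fin as Fin using (Fin; toℕ; fromℕ)
open import Data.Fin.Properties using (toℕ<n)
open import Data.Integer as ℤ using (ℤ; +_; -_; _+_; _-_; _*_)
import Data.Integer.Properties as ℤ
open import Data.Integer.Tactic.RingSolver using (solve-∀)
open import Data.List as List using (List; []; _∷_; [_]; _++_; map; concatMap; length; filter; allFin; applyUpTo; upTo)
import Data.List.Properties as List
open import Data.List.Membership.Propositional using (_∈_; _∉_; find; lose)
open import Data.List.Membership.Propositional.Properties
open import Data.List.Membership.Propositional.Properties.WithK using (unique∧set⇒bag)
open import Data.List.Relation.Binary.BagAndSetEquality using (∼bag⇒↭)
open import Data.List.Relation.Binary.Permutation.Propositional
  using (_↭_; prep; swap; ↭-refl; ↭-reflexive; ↭-trans; ↭-sym; ↭⇒↭ₛ)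
  renaming (refl to ↭-refl′; trans to ↭-trans′)
open import Data.List.Relation.Binary.Permutation.Propositional.Properties
  using (++⁺; ++⁺ˡ; map⁺; ++-commutativeMonoid; All-resp-↭; ∈-resp-↭; ↭-length; shift)
import Data.List.Relation.Binary.Permutation.Setoid.Properties as Permutationₛ
open import Data.List.Relation.Unary.All as All using (All; []; _∷_)
import Data.List.Relation.Unary.All.Properties as All
open import Data.List.Relation.Unary.Any using (here; there; any?)
open import Data.List.Relation.Unary.Unique.Propositional using (Unique; []; _∷_)
import Data.List.Relation.Unary.Unique.Propositional.Properties as Unique
open import Data.Nat as ℕ using (ℕ; zero; suc; _≤_; _<_; _∸_; _<ᵇ_; z≤n; s≤s)
import Data.Nat.Properties as ℕ
open import Data.List.Membership.DecPropositional ℕ._≟_ using (_∈?_)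
open import Data.List.Relation.Unary.Unique.DecPropositional ℕ._≟_ using (unique?)
open import Data.Product using (_×_; _,_; proj₁; proj₂; ∃; ∃₂)
open import Data.Sum using (_⊎_; inj₁; inj₂; [_,_]′)
open import Data.Vec as Vec using (Vec; tabulate; updateAt; lookup; _∷ʳ_)
import Data.Vec.Properties as Vec
open import Function using (_∘′_; case_of_)
open import Function.Bundles using (Equivalence; mk⇔)
open import Level using (0ℓ)
open import Relation.Binary.PropositionalEquality hiding ([_])
open import Relation.Nullary using (¬_; Dec; does; yes; no; ¬?; _×-dec_)
open import Relation.Nullary.Decidable using (does-⇔; dec-true; dec-false)
open import Relation.Unary using (Pred; Decidable)

∑ : {A : Set} → List A → (A → ℤ) → ℤ
∑ []       f = + 0
∑ (x ∷ xs) f = f x + ∑ xs f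

module _ {A : Set} where

  ∑-++ : ∀ (xs ys : List A) f → ∑ (xs ++ ys) f ≡ ∑ xs f + ∑ ys f
  ∑-++ []       ys f = sym (ℤ.+-identityˡ _)
  ∑-++ (x ∷ xs) ys f = trans (cong (λ s → f x + s) (∑-++ xs ys f)) (sym (ℤ.+-assoc (f x) _ _))

  ∑-cong : ∀ (xs : List A) {f g} → (∀ x → f x ≡ g x) → ∑ xs f ≡ ∑ xs g
  ∑-cong []       f≗g = refl
  ∑-cong (x ∷ xs) f≗g = cong₂ _+_ (f≗g x) (∑-cong xs f≗g)

  ∑-↭ : ∀ {xs ys : List A} f → xs ↭ ys → ∑ xs f ≡ ∑ ys f
  ∑-↭ f ↭-refl′           = refl
  ∑-↭ f (prep x p)        = cong (λ s → f x + s) (∑-↭ f p)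
  ∑-↭ f (swap x y p)      = trans (cong (λ s → f x + (f y + s)) (∑-↭ f p)) (left-comm (f x) (f y) _)
    where
    left-comm : ∀ a b c → a + (b + c) ≡ b + (a + c)
    left-comm = solve-∀
  ∑-↭ f (↭-trans′ p q)    = trans (∑-↭ f p) (∑-↭ f q)

  ∑-const : ∀ (xs : List A) c → ∑ xs (λ _ → c) ≡ + length xs * c
  ∑-const []       c = sym (ℤ.*-zeroˡ c)
  ∑-const (x ∷ xs) c = trans (cong (λ s → c + s) (∑-const xs c)) (step (+ length xs) c)
    where
    step : ∀ m c → c + m * c ≡ (+ 1 + m) * c
    step = solve-∀

  ∑-- : ∀ (xs : List A) f g → ∑ xs (λ x → f x - g x) ≡ ∑ xs f - ∑ xs g
  ∑-- []       f g = refl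
  ∑-- (x ∷ xs) f g = trans (cong (λ s → f x - g x + s) (∑-- xs f g)) (shuffle (f x) (g x) _ _)
    where
    shuffle : ∀ a b c d → a - b + (c - d) ≡ a + c - (b + d)
    shuffle = solve-∀

  ∑-* : ∀ (xs : List A) c f → ∑ xs (λ x → c * f x) ≡ c * ∑ xs f
  ∑-* []       c f = sym (ℤ.*-zeroʳ c)
  ∑-* (x ∷ xs) c f = trans (cong (λ s → c * f x + s) (∑-* xs c f)) (sym (ℤ.*-distribˡ-+ c (f x) _))

∑-map : ∀ {A B : Set} (h : A → B) (xs : List A) f → ∑ (map h xs) f ≡ ∑ xs (λ x → f (h x))
∑-map h []       f = refl
∑-map h (x ∷ xs) f = cong (λ s → f (h x) + s) (∑-map h xs f)

tabulate-toℕ : ∀ {A : Set} n (f : ℕ → A) → List.tabulate (λ (i : Fin n) → f (toℕ i)) ≡ applyUpTo f n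
tabulate-toℕ zero    f = refl
tabulate-toℕ (suc n) f = cong (f 0 ∷_) (tabulate-toℕ n (λ x → f (suc x)))

∑-allFin : ∀ n f → ∑ (allFin n) (λ i → f (suc (toℕ i))) ≡ ∑ (range n) f
∑-allFin n f = begin
  ∑ (allFin n) (λ i → f (suc (toℕ i)))        ≡⟨ ∑-map (λ i → suc (toℕ i)) (allFin n) f ⟨
  ∑ (map (λ i → suc (toℕ i)) (allFin n)) f     ≡⟨ cong (λ xs → ∑ xs f) indices ⟩
  ∑ (range n) f                                ∎
  where
  open ≡-Reasoning
  indices : map (λ i → suc (toℕ i)) (allFin n) ≡ range n
  indices = trans (List.map-tabulate (λ i → i) (λ i → suc (toℕ i)))
              (trans (tabulate-toℕ n suc) (sym (List.map-applyUpTo (λ i → i) suc n)))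

unique-↭ : ∀ {A : Set} {xs ys : List A} → Unique xs → Unique ys →
  (∀ {x} → x ∈ xs → x ∈ ys) → (∀ {x} → x ∈ ys → x ∈ xs) → xs ↭ ys
unique-↭ uxs uys xs⊆ys ys⊆xs = ∼bag⇒↭ (unique∧set⇒bag uxs uys (mk⇔ xs⊆ys ys⊆xs))

∑-restrict : ∀ {xs ys : List ℕ} h → Unique xs → Unique ys → (∀ {x} → x ∈ ys → x ∈ xs) →
  ∑ xs (λ x → if does (x ∈? ys) then h x else + 0) ≡ ∑ ys h
∑-restrict {xs} {ys} h uxs uys ys⊆xs =
  trans (∑-filter xs)
    (∑-↭ h (unique-↭ (Unique.filter⁺ (_∈? ys) uxs) uys
      (λ x∈ → proj₂ (∈-filter⁻ (_∈? ys) {xs = xs} x∈))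
      (λ x∈ → ∈-filter⁺ (_∈? ys) {xs = xs} (ys⊆xs x∈) x∈)))
  where
  ∑-filter : ∀ xs → ∑ xs (λ x → if does (x ∈? ys) then h x else + 0) ≡ ∑ (filter (_∈? ys) xs) h
  ∑-filter []       = refl
  ∑-filter (x ∷ xs) with does (x ∈? ys)
  ... | true  = cong (λ s → h x + s) (∑-filter xs)
  ... | false = trans (ℤ.+-identityˡ _) (∑-filter xs)

adjacentSum : (ℕ → ℕ → ℤ) → List ℕ → ℤ
adjacentSum g (a ∷ b ∷ r) = g a b + adjacentSum g (b ∷ r)
adjacentSum g _           = + 0

lastOf : ℕ → List ℕ → ℕ
lastOf a []      = a
lastOf a (b ∷ s) = lastOf b s

lastOf-∷ʳ : ∀ a s → ∃ λ u → a ∷ s ≡ u ++ [ lastOf a s ]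
lastOf-∷ʳ a []      = [] , refl
lastOf-∷ʳ a (b ∷ s) with lastOf-∷ʳ b s
... | u , eq = a ∷ u , cong (a ∷_) eq

adjacentSum-telescope : ∀ c f a s →
  adjacentSum (λ x y → c - f x - f y) (a ∷ s) ≡ + length s * c - + 2 * ∑ (a ∷ s) f + f a + f (lastOf a s)
adjacentSum-telescope c f a []      = base c (f a)
  where
  base : ∀ c x → + 0 ≡ + 0 * c - + 2 * (x + + 0) + x + x
  base = solve-∀
adjacentSum-telescope c f a (b ∷ s) = begin
  c - f a - f b + adjacentSum _ (b ∷ s)
    ≡⟨ cong (λ t → c - f a - f b + t) (adjacentSum-telescope c f b s) ⟩
  c - f a - f b + (+ length s * c - + 2 * ∑ (b ∷ s) f + f b + f (lastOf b s))
    ≡⟨ step c (f a) (f b) (∑ s f) (f (lastOf b s)) (+ length s) ⟩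
  (+ 1 + + length s) * c - + 2 * ∑ (a ∷ b ∷ s) f + f a + f (lastOf b s)
    ≡⟨ cong (λ m → m * c - + 2 * ∑ (a ∷ b ∷ s) f + f a + f (lastOf b s)) (ℤ.pos-+ 1 (length s)) ⟨
  + length (b ∷ s) * c - + 2 * ∑ (a ∷ b ∷ s) f + f a + f (lastOf b s) ∎
  where
  open ≡-Reasoning
  step : ∀ c x y S l m → c - x - y + (m * c - + 2 * (y + S) + y + l)
                       ≡ (+ 1 + m) * c - + 2 * (x + (y + S)) + x + l
  step = solve-∀

termCoeff : ∀ {n} → Vec ℕ n → ℕ → Term n → ℤ
termCoeff e k (c , e′ , k′) = if does (Vec.≡-dec ℕ._≟_ e′ e) ∧ does (k′ ℕ.≟ k) then c else + 0

coeff≡∑ : ∀ {n} (p : Poly n) e k → coeff p e k ≡ ∑ p (termCoeff e k)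
coeff≡∑ []              e k = refl
coeff≡∑ (t@(c , e′ , k′) ∷ p) e k = cong (λ s → termCoeff e k t + s) (coeff≡∑ p e k)

coeff-++ : ∀ {n} (p q : Poly n) e k → coeff (p ++ q) e k ≡ coeff p e k + coeff q e k
coeff-++ p q e k rewrite coeff≡∑ (p ++ q) e k | coeff≡∑ p e k | coeff≡∑ q e k = ∑-++ p q _

↭⇒≈P : ∀ {n} {p q : Poly n} → p ↭ q → p ≈P q
↭⇒≈P {p = p} {q} p↭q e k rewrite coeff≡∑ p e k | coeff≡∑ q e k = ∑-↭ _ p↭q

termCoeff-scalar : ∀ {m} (E : Vec ℕ m) K c v j → termCoeff E K (c , v , j) ≡ c * termCoeff E K (+ 1 , v , j)
termCoeff-scalar E K c v j with does (Vec.≡-dec ℕ._≟_ v E) ∧ does (j ℕ.≟ K)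
... | true  = sym (ℤ.*-identityʳ c)
... | false = sym (ℤ.*-zeroʳ c)

coeff-map⁴ : ∀ {A : Set} {l m n} (f : Term n → Term n) (g : Term m → Term n) (h : Term l → Term m)
  (d : A → Term l) xs E K →
  coeff (map f (map g (map h (map d xs)))) E K ≡ ∑ xs (λ x → termCoeff E K (f (g (h (d x)))))
coeff-map⁴ f g h d xs E K =
  trans (coeff≡∑ (map f (map g (map h (map d xs)))) E K)
    (trans (∑-map f (map g (map h (map d xs))) _) (trans (∑-map g (map h (map d xs)) _)
      (trans (∑-map h (map d xs) _) (∑-map d xs _))))

-- Additivity of the recurrence operator

++-interchange : ∀ {A : Set} (a b c d : List A) → (a ++ b) ++ (c ++ d) ↭ (a ++ c) ++ (b ++ d)
++-interchange = interchange (CommutativeMonoid.commutativeSemigroup ++-commutativeMonoid)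

Additive : ∀ {m n} → (Poly m → Poly n) → Set
Additive F = ∀ p q → F (p ++ q) ↭ F p ++ F q

map-additive : ∀ {m n} (f : Term m → Term n) → Additive (map f)
map-additive f p q = ↭-reflexive (List.map-++ f p q)

map∘-additive : ∀ {l m n} (f : Term m → Term n) (G : Poly l → Poly m) →
  Additive G → Additive (λ p → map f (G p))
map∘-additive f G G+ p q = ↭-trans (map⁺ f (G+ p q)) (map-additive f (G p) (G q))

⊕-additive : ∀ {m n} (F G : Poly m → Poly n) → Additive F → Additive G → Additive (λ p → F p ⊕ G p)
⊕-additive F G F+ G+ p q =
  ↭-trans (++⁺ (F+ p q) (G+ p q)) (++-interchange (F p) (F q) (G p) (G q))

concatMap-++ : ∀ {A B : Set} (F G : A → List B) (xs : List A) →
  concatMap (λ x → F x ++ G x) xs ↭ concatMap F xs ++ concatMap G xs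
concatMap-++ F G []       = ↭-refl
concatMap-++ F G (x ∷ xs) =
  ↭-trans (++⁺ˡ (F x ++ G x) (concatMap-++ F G xs)) (++-interchange (F x) (G x) _ _)

sumdX-additive : ∀ {n} → Additive (sumdX {n})
sumdX-additive {n} p q =
  ↭-trans (↭-reflexive (List.concatMap-cong (λ i → List.map-++ _ p q) (allFin n)))
          (concatMap-++ (λ i → dX i p) (λ i → dX i q) (allFin n))

module _ (n : ℕ) where

  doubled xTopTimes xTopDerivatives xTopY²Derivative : Poly n → Poly (suc n)
  doubled          p = scale (+ 2) (lift p)
  xTopTimes        p = scale (+ (n ∸ 1)) (mulY (mulX (fromℕ n) (lift p)))
  xTopDerivatives  p = scale (+ 2) (mulX (fromℕ n) (lift (sumdX p)))
  xTopY²Derivative p = scale (- (+ 2)) (mulX (fromℕ n) (mulY (mulY (lift (dY p)))))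

  recurrence : Poly n → Poly (suc n)
  recurrence p = doubled p ⊕ xTopTimes p ⊕ xTopDerivatives p ⊕ xTopY²Derivative p

  recurrence-additive : Additive recurrence
  recurrence-additive =
    ⊕-additive (λ p → doubled p ⊕ xTopTimes p ⊕ xTopDerivatives p) xTopY²Derivative
      (⊕-additive (λ p → doubled p ⊕ xTopTimes p) xTopDerivatives
        (⊕-additive doubled xTopTimes doubled-additive xTopTimes-additive)
        xTopDerivatives-additive)
      xTopY²Derivative-additive
    where
    doubled-additive : Additive doubled
    doubled-additive = map∘-additive _ lift (map-additive _)
    xTopTimes-additive : Additive xTopTimes
    xTopTimes-additive =
      map∘-additive _ (λ p → mulY (mulX (fromℕ n) (lift p)))
        (map∘-additive _ (λ p → mulX (fromℕ n) (lift p)) (map∘-additive _ lift (map-additive _)))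
    xTopDerivatives-additive : Additive xTopDerivatives
    xTopDerivatives-additive =
      map∘-additive _ (λ p → mulX (fromℕ n) (lift (sumdX p)))
        (map∘-additive _ (λ p → lift (sumdX p)) (map∘-additive _ sumdX sumdX-additive))
    xTopY²Derivative-additive : Additive xTopY²Derivative
    xTopY²Derivative-additive =
      map∘-additive _ (λ p → mulX (fromℕ n) (mulY (mulY (lift (dY p)))))
        (map∘-additive _ (λ p → mulY (mulY (lift (dY p))))
          (map∘-additive _ (λ p → mulY (lift (dY p)))
            (map∘-additive _ (λ p → lift (dY p)) (map∘-additive _ dY (map-additive _)))))

recurrence-[] : ∀ n → recurrence n [] ≡ []
recurrence-[] n =
  trans (List.++-identityʳ _) (cong (λ p → scale (+ 2) (mulX (fromℕ n) (lift p))) (vanish (allFin n)))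
  where
  vanish : (is : List (Fin n)) → concatMap (λ i → dX i []) is ≡ []
  vanish []       = refl
  vanish (_ ∷ is) = vanish is

-- Permutations of [n + 1] as insertions of n + 1

∈-words⁻ : ∀ k A {w} → w ∈ words k A → length w ≡ k × All (_∈ A) w
∈-words⁻ zero    A (here refl) = refl , []
∈-words⁻ (suc k) A w∈ with find (∈-concatMap⁻ (λ a → map (a ∷_) (words k A)) {xs = A} w∈)
... | a , a∈A , w∈a with ∈-map⁻ (a ∷_) w∈a
... | w′ , w′∈ , refl with ∈-words⁻ k A w′∈
... | len , all = cong suc len , a∈A ∷ all

∈-words⁺ : ∀ k A {w} → length w ≡ k → All (_∈ A) w → w ∈ words k A
∈-words⁺ zero    A {[]}    refl []          = here refl
∈-words⁺ (suc k) A {a ∷ w} len  (a∈A ∷ all) =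
  ∈-concatMap⁺ (λ a → map (a ∷_) (words k A)) {xs = A}
    (lose a∈A (∈-map⁺ (a ∷_) (∈-words⁺ k A (ℕ.suc-injective len) all)))

words-unique : ∀ k A → Unique A → Unique (words k A)
words-unique zero    A _  = [] ∷ []
words-unique (suc k) A uA = go A uA
  where
  extend : ℕ → List (List ℕ)
  extend a = map (a ∷_) (words k A)
  go : ∀ B → Unique B → Unique (concatMap extend B)
  go []      _          = []
  go (a ∷ B) (a∉B ∷ uB) =
    Unique.++⁺ (Unique.map⁺ List.∷-injectiveʳ (words-unique k A uA)) (go B uB) disjoint
    where
    disjoint : ∀ {v} → ¬ (v ∈ extend a × v ∈ concatMap extend B)
    disjoint (v∈a , v∈B) with ∈-map⁻ (a ∷_) v∈a | find (∈-concatMap⁻ extend {xs = B} v∈B)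
    ... | _ , _ , refl | b , b∈B , v∈b with ∈-map⁻ (b ∷_) v∈b
    ... | _ , _ , eq = All.lookup a∉B b∈B (List.∷-injectiveˡ eq)

∈-range⁻ : ∀ {n x} → x ∈ range n → 1 ≤ x × x ≤ n
∈-range⁻ x∈ with ∈-map⁻ suc x∈
... | y , y∈ , refl = s≤s z≤n , ∈-upTo⁻ y∈

∈-range⁺ : ∀ {n x} → 1 ≤ x → x ≤ n → x ∈ range n
∈-range⁺ {x = suc y} (s≤s _) x≤n = ∈-map⁺ suc (∈-upTo⁺ x≤n)

range-unique : ∀ n → Unique (range n)
range-unique n = Unique.map⁺ ℕ.suc-injective (Unique.upTo⁺ n)

length-range : ∀ n → length (range n) ≡ n
length-range n = trans (List.length-map suc (upTo n)) (List.length-upTo n)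

IsPerm : ℕ → List ℕ → Set
IsPerm n τ = length τ ≡ n × All (_∈ range n) τ × Unique τ

∈-perms⁻ : ∀ {n τ} → τ ∈ perms n → IsPerm n τ
∈-perms⁻ {n} τ∈ with ∈-filter⁻ (λ w → unique? w) {xs = words n (range n)} τ∈
... | τ∈words , uτ with ∈-words⁻ n (range n) τ∈words
...   | len , all = len , all , uτ

∈-perms⁺ : ∀ {n τ} → IsPerm n τ → τ ∈ perms n
∈-perms⁺ {n} (len , all , uτ) =
  ∈-filter⁺ (λ w → unique? w) {xs = words n (range n)} (∈-words⁺ n (range n) len all) uτ

perms-unique : ∀ n → Unique (perms n)
perms-unique n = Unique.filter⁺ (λ w → unique? w) (words-unique n (range n) (range-unique n))

unique-resp-↭ : ∀ {xs ys : List ℕ} → xs ↭ ys → Unique xs → Unique ys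
unique-resp-↭ p = Permutationₛ.Unique-resp-↭ (setoid ℕ) (↭⇒↭ₛ p)

IsPerm-resp-↭ : ∀ {n σ τ} → σ ↭ τ → IsPerm n σ → IsPerm n τ
IsPerm-resp-↭ p (len , all , uσ) = trans (sym (↭-length p)) len , All-resp-↭ p all , unique-resp-↭ p uσ

top∉range : ∀ {n x} → x ∈ range n → x ≢ suc n
top∉range x∈ refl = ℕ.<-irrefl refl (proj₂ (∈-range⁻ x∈))

∈-range-suc⁺ : ∀ {n x} → x ∈ range n → x ∈ range (suc n)
∈-range-suc⁺ x∈ with ∈-range⁻ x∈
... | 1≤x , x≤n = ∈-range⁺ 1≤x (ℕ.m≤n⇒m≤1+n x≤n)

∈-range-suc⁻ : ∀ {n x} → x ∈ range (suc n) → x ≢ suc n → x ∈ range n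
∈-range-suc⁻ x∈ x≢top with ∈-range⁻ x∈
... | 1≤x , x≤1+n = ∈-range⁺ 1≤x (ℕ.≤-pred (ℕ.≤∧≢⇒< x≤1+n x≢top))

IsPerm-∷⁺ : ∀ {n σ} → IsPerm n σ → IsPerm (suc n) (suc n ∷ σ)
IsPerm-∷⁺ (len , all , uσ) =
  cong suc len ,
  ∈-range⁺ (s≤s z≤n) ℕ.≤-refl ∷ All.map ∈-range-suc⁺ all ,
  All.map (λ x∈ → top∉range x∈ ∘′ sym) all ∷ uσ

IsPerm-∷⁻ : ∀ {n σ} → IsPerm (suc n) (suc n ∷ σ) → IsPerm n σ
IsPerm-∷⁻ (len , _ ∷ all , top∉σ ∷ uσ) =
  ℕ.suc-injective len ,
  All.zipWith (λ (top≢x , x∈) → ∈-range-suc⁻ x∈ (top≢x ∘′ sym)) (top∉σ , all) ,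
  uσ

∈-++-∷⁻ : ∀ {x y : ℕ} u v → x ∈ u ++ y ∷ v → x ≢ y → x ∈ u ++ v
∈-++-∷⁻ {y = y} u v x∈ x≢y with ∈-resp-↭ (shift y u v) x∈
... | here x≡y = ⊥-elim (x≢y x≡y)
... | there x∈′ = x∈′

unique⊆⇒length≤ : ∀ {xs ys : List ℕ} → Unique xs → All (_∈ ys) xs → length xs ≤ length ys
unique⊆⇒length≤ {[]}     _          _            = z≤n
unique⊆⇒length≤ {x ∷ xs} (x∉xs ∷ u) (x∈ys ∷ all) with ∈-∃++ x∈ys
... | u′ , v′ , refl =
  ℕ.≤-trans (s≤s (unique⊆⇒length≤ u xs⊆u′v′)) (ℕ.≤-reflexive (sym (List.length-++-sucʳ u′ x v′)))
  where
  xs⊆u′v′ : All (_∈ u′ ++ v′) xs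
  xs⊆u′v′ = All.zipWith (λ (x≢z , z∈) → ∈-++-∷⁻ u′ v′ z∈ (x≢z ∘′ sym)) (x∉xs , all)

∈-++-∷⁺ : ∀ {x y : ℕ} u v → x ∈ u ++ v → x ∈ u ++ y ∷ v
∈-++-∷⁺ {y = y} u v x∈ = ∈-resp-↭ (↭-sym (shift y u v)) (there x∈)

unique-++-∷⁻ : ∀ {x : ℕ} u v → Unique (u ++ x ∷ v) → x ∉ u ++ v × Unique (u ++ v)
unique-++-∷⁻ {x} u v uτ with unique-resp-↭ (shift x u v) uτ
... | x∉ ∷ u′ = All.All¬⇒¬Any x∉ , u′

top∈perm : ∀ {n τ} → IsPerm (suc n) τ → suc n ∈ τ
top∈perm {n} {τ} (len , all , uτ) with any? (suc n ℕ.≟_) τ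
... | yes top∈τ = top∈τ
... | no  top∉τ = ⊥-elim (ℕ.<-irrefl refl (begin-strict
  n                <⟨ ℕ.n<1+n n ⟩
  suc n            ≡⟨ sym len ⟩
  length τ         ≤⟨ unique⊆⇒length≤ uτ (All.zipWith shrink (All.¬Any⇒All¬ τ top∉τ , all)) ⟩
  length (range n) ≡⟨ length-range n ⟩
  n                ∎))
  where
  open ℕ.≤-Reasoning
  shrink : ∀ {x} → suc n ≢ x × x ∈ range (suc n) → x ∈ range n
  shrink (top≢x , x∈) = ∈-range-suc⁻ x∈ (top≢x ∘′ sym)

insertions : ℕ → List ℕ → List (List ℕ)
insertions M []      = [ [ M ] ]
insertions M (a ∷ σ) = (M ∷ a ∷ σ) ∷ map (a ∷_) (insertions M σ)

∈-insertions⁺ : ∀ M u v → u ++ M ∷ v ∈ insertions M (u ++ v)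
∈-insertions⁺ M []      []      = here refl
∈-insertions⁺ M []      (_ ∷ _) = here refl
∈-insertions⁺ M (a ∷ u) v       = there (∈-map⁺ (a ∷_) (∈-insertions⁺ M u v))

∈-insertions⁻ : ∀ M σ {τ} → τ ∈ insertions M σ → ∃₂ λ u v → σ ≡ u ++ v × τ ≡ u ++ M ∷ v
∈-insertions⁻ M []      (here refl) = [] , [] , refl , refl
∈-insertions⁻ M (a ∷ σ) (here refl) = [] , a ∷ σ , refl , refl
∈-insertions⁻ M (a ∷ σ) (there τ∈) with ∈-map⁻ (a ∷_) τ∈
... | τ′ , τ′∈ , refl with ∈-insertions⁻ M σ τ′∈
... | u , v , refl , refl = a ∷ u , v , refl , refl

insertions-unique : ∀ M σ → M ∉ σ → Unique (insertions M σ)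
insertions-unique M []      _    = [] ∷ []
insertions-unique M (a ∷ σ) M∉aσ =
  All.map⁺ (All.tabulate (λ _ eq → M∉aσ (here (List.∷-injectiveˡ eq))))
  ∷ Unique.map⁺ List.∷-injectiveʳ (insertions-unique M σ (M∉aσ ∘′ there))

++-∷-cancel : ∀ {M : ℕ} u v u′ v′ → M ∉ u → M ∉ u′ → u ++ M ∷ v ≡ u′ ++ M ∷ v′ → u ++ v ≡ u′ ++ v′
++-∷-cancel []      v []       v′ _    _     eq = List.∷-injectiveʳ eq
++-∷-cancel []      v (a ∷ u′) v′ _    M∉au′ eq = ⊥-elim (M∉au′ (here (List.∷-injectiveˡ eq)))
++-∷-cancel (a ∷ u) v []       v′ M∉au _     eq = ⊥-elim (M∉au (here (sym (List.∷-injectiveˡ eq))))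
++-∷-cancel (a ∷ u) v (b ∷ u′) v′ M∉au M∉bu′ eq =
  cong₂ _∷_ (List.∷-injectiveˡ eq)
            (++-∷-cancel u v u′ v′ (M∉au ∘′ there) (M∉bu′ ∘′ there) (List.∷-injectiveʳ eq))

insertions-injective : ∀ M σ σ′ {τ} → M ∉ σ → M ∉ σ′ →
  τ ∈ insertions M σ → τ ∈ insertions M σ′ → σ ≡ σ′
insertions-injective M σ σ′ M∉σ M∉σ′ τ∈ τ∈′ with ∈-insertions⁻ M σ τ∈ | ∈-insertions⁻ M σ′ τ∈′
... | u , v , refl , refl | u′ , v′ , refl , eq =
  ++-∷-cancel u v u′ v′ (M∉σ ∘′ ∈-++⁺ˡ) (M∉σ′ ∘′ ∈-++⁺ˡ) eq

concatMap-insertions-unique : ∀ M σs → Unique σs → All (M ∉_) σs → Unique (concatMap (insertions M) σs)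
concatMap-insertions-unique M []       _          _             = []
concatMap-insertions-unique M (σ ∷ σs) (σ∉σs ∷ u) (M∉σ ∷ M∉σs) =
  Unique.++⁺ (insertions-unique M σ M∉σ) (concatMap-insertions-unique M σs u M∉σs) disjoint
  where
  disjoint : ∀ {τ} → ¬ (τ ∈ insertions M σ × τ ∈ concatMap (insertions M) σs)
  disjoint (τ∈ , τ∈σs) with find (∈-concatMap⁻ (insertions M) {xs = σs} τ∈σs)
  ... | σ′ , σ′∈ , τ∈′ =
    All.lookup σ∉σs σ′∈ (insertions-injective M σ σ′ M∉σ (All.lookup M∉σs σ′∈) τ∈ τ∈′)

perms-suc-↭ : ∀ n → perms (suc n) ↭ concatMap (insertions (suc n)) (perms n)
perms-suc-↭ n = unique-↭ (perms-unique (suc n)) unique to from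
  where
  M = suc n
  unique : Unique (concatMap (insertions M) (perms n))
  unique = concatMap-insertions-unique M (perms n) (perms-unique n)
             (All.tabulate (λ σ∈ M∈σ → top∉range (All.lookup (proj₁ (proj₂ (∈-perms⁻ σ∈))) M∈σ) refl))
  to : ∀ {τ} → τ ∈ perms M → τ ∈ concatMap (insertions M) (perms n)
  to τ∈ with ∈-perms⁻ τ∈
  ... | τ-perm with ∈-∃++ (top∈perm {n} τ-perm)
  ... | u , v , refl =
    ∈-concatMap⁺ (insertions M) {xs = perms n}
      (lose (∈-perms⁺ (IsPerm-∷⁻ (IsPerm-resp-↭ (shift M u v) τ-perm))) (∈-insertions⁺ M u v))
  from : ∀ {τ} → τ ∈ concatMap (insertions M) (perms n) → τ ∈ perms M
  from τ∈ with find (∈-concatMap⁻ (insertions M) {xs = perms n} τ∈)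
  ... | σ , σ∈ , τ∈σ with ∈-insertions⁻ M σ τ∈σ
  ... | u , v , refl , refl =
    ∈-perms⁺ (IsPerm-resp-↭ (↭-sym (shift M u v)) (IsPerm-∷⁺ (∈-perms⁻ σ∈)))

-- Circular peaks

peak : ℕ → ℕ → ℕ → List ℕ
peak a b c = if (a <ᵇ b) ∧ (c <ᵇ b) then [ b ] else []

peak-cases : ∀ a b c → peak a b c ≡ [] ⊎ (peak a b c ≡ [ b ] × a < b × c < b)
peak-cases a b c with (a <ᵇ b) ∧ (c <ᵇ b) in eq
... | false = inj₁ refl
... | true with Equivalence.to T-∧ (Equivalence.from T-≡ eq)
...   | a<ᵇb , c<ᵇb = inj₂ (refl , ℕ.<ᵇ⇒< a b a<ᵇb , ℕ.<ᵇ⇒< c b c<ᵇb)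

peak-top : ∀ {a b c} → a < b → c < b → peak a b c ≡ [ b ]
peak-top {a} {b} {c} a<b c<b
  rewrite Equivalence.to T-≡ (ℕ.<⇒<ᵇ a<b) | Equivalence.to T-≡ (ℕ.<⇒<ᵇ c<b) = refl

peak-≥ˡ : ∀ {a b} c → b ≤ a → peak a b c ≡ []
peak-≥ˡ {a} {b} c b≤a with peak-cases a b c
... | inj₁ none            = none
... | inj₂ (_ , a<b , _)   = ⊥-elim (ℕ.<⇒≱ a<b b≤a)

peak-≥ʳ : ∀ a {b c} → b ≤ c → peak a b c ≡ []
peak-≥ʳ a {b} {c} b≤c with peak-cases a b c
... | inj₁ none            = none
... | inj₂ (_ , _ , c<b)   = ⊥-elim (ℕ.<⇒≱ c<b b≤c)

CP-∷∷∷ : ∀ a b c r → CP (a ∷ b ∷ c ∷ r) ≡ peak a b c ++ CP (b ∷ c ∷ r)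
CP-∷∷∷ a b c r with (a <ᵇ b) ∧ (c <ᵇ b)
... | true  = refl
... | false = refl

headPeak : ℕ → ℕ → List ℕ → List ℕ
headPeak a b []      = []
headPeak a b (c ∷ _) = peak a b c

CP-∷∷ : ∀ a b r → CP (a ∷ b ∷ r) ≡ headPeak a b r ++ CP (b ∷ r)
CP-∷∷ a b []      = refl
CP-∷∷ a b (c ∷ r) = CP-∷∷∷ a b c r

headPeak-cases : ∀ a b r → headPeak a b r ≡ [] ⊎ (headPeak a b r ≡ [ b ] × a < b)
headPeak-cases a b []      = inj₁ refl
headPeak-cases a b (c ∷ r) with peak-cases a b c
... | inj₁ none                = inj₁ none
... | inj₂ (single , a<b , _)  = inj₂ (single , a<b)

headPeak-≥ˡ : ∀ {a b} r → b ≤ a → headPeak a b r ≡ []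
headPeak-≥ˡ []      b≤a = refl
headPeak-≥ˡ (c ∷ r) b≤a = peak-≥ˡ c b≤a

∈-headPeak : ∀ a b r {x} → x ∈ headPeak a b r → x ≡ b
∈-headPeak a b r {x} x∈ with headPeak-cases a b r
... | inj₁ none = case subst (x ∈_) none x∈ of λ ()
... | inj₂ (single , _) with subst (x ∈_) single x∈
...   | here x≡b = x≡b

peakAt : List ℕ → ℕ → List ℕ → List ℕ
peakAt []          l v = []
peakAt (x ∷ [])    l v = headPeak x l v
peakAt (x ∷ y ∷ u) l v = peakAt (y ∷ u) l v

peakAt-cases : ∀ u l h v → peakAt u l (h ∷ v) ≡ [] ⊎ (peakAt u l (h ∷ v) ≡ [ l ] × h < l)
peakAt-cases []          l h v = inj₁ refl
peakAt-cases (x ∷ [])    l h v with peak-cases x l h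
... | inj₁ none                = inj₁ none
... | inj₂ (single , _ , h<l)  = inj₂ (single , h<l)
peakAt-cases (x ∷ y ∷ u) l h v = peakAt-cases (y ∷ u) l h v

peakAt-≥ʳ : ∀ u {l h} v → l ≤ h → peakAt u l (h ∷ v) ≡ []
peakAt-≥ʳ []          v l≤h = refl
peakAt-≥ʳ (x ∷ [])    v l≤h = peak-≥ʳ x l≤h
peakAt-≥ʳ (x ∷ y ∷ u) v l≤h = peakAt-≥ʳ (y ∷ u) v l≤h

CP-split : ∀ u l v → CP (u ++ l ∷ v) ≡ CP (u ++ [ l ]) ++ peakAt u l v ++ CP (l ∷ v)
CP-split []          l v = refl
CP-split (x ∷ [])    l v = CP-∷∷ x l v
CP-split (x ∷ y ∷ u) l v = begin
  CP (x ∷ y ∷ u ++ l ∷ v)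
    ≡⟨ CP-∷∷ x y (u ++ l ∷ v) ⟩
  headPeak x y (u ++ l ∷ v) ++ CP (y ∷ u ++ l ∷ v)
    ≡⟨ cong₂ _++_ (same-head u) (CP-split (y ∷ u) l v) ⟩
  headPeak x y (u ++ [ l ]) ++ CP (y ∷ u ++ [ l ]) ++ rest
    ≡⟨ List.++-assoc (headPeak x y (u ++ [ l ])) _ rest ⟨
  (headPeak x y (u ++ [ l ]) ++ CP (y ∷ u ++ [ l ])) ++ rest
    ≡⟨ cong (_++ rest) (CP-∷∷ x y (u ++ [ l ])) ⟨
  CP (x ∷ y ∷ u ++ [ l ]) ++ rest ∎
  where
  open ≡-Reasoning
  rest = peakAt (y ∷ u) l v ++ CP (l ∷ v)
  same-head : ∀ u → headPeak x y (u ++ l ∷ v) ≡ headPeak x y (u ++ [ l ])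
  same-head []      = refl
  same-head (_ ∷ _) = refl

CP-insert-between : ∀ w {a M b} r → a < M → b < M →
  CP (w ++ a ∷ M ∷ b ∷ r) ≡ CP (w ++ [ a ]) ++ M ∷ CP (b ∷ r)
CP-insert-between w {a} {M} {b} r a<M b<M = begin
  CP (w ++ a ∷ M ∷ b ∷ r)
    ≡⟨ CP-split w a (M ∷ b ∷ r) ⟩
  CP (w ++ [ a ]) ++ peakAt w a (M ∷ b ∷ r) ++ CP (a ∷ M ∷ b ∷ r)
    ≡⟨ cong₂ (λ p q → CP (w ++ [ a ]) ++ p ++ q) (peakAt-≥ʳ w (b ∷ r) (ℕ.<⇒≤ a<M)) (CP-∷∷∷ a M b r) ⟩
  CP (w ++ [ a ]) ++ peak a M b ++ CP (M ∷ b ∷ r)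
    ≡⟨ cong (λ p → CP (w ++ [ a ]) ++ p ++ CP (M ∷ b ∷ r)) (peak-top a<M b<M) ⟩
  CP (w ++ [ a ]) ++ M ∷ CP (M ∷ b ∷ r)
    ≡⟨ cong (λ p → CP (w ++ [ a ]) ++ M ∷ p) (CP-∷∷ M b r) ⟩
  CP (w ++ [ a ]) ++ M ∷ headPeak M b r ++ CP (b ∷ r)
    ≡⟨ cong (λ p → CP (w ++ [ a ]) ++ M ∷ p ++ CP (b ∷ r)) (headPeak-≥ˡ r (ℕ.<⇒≤ b<M)) ⟩
  CP (w ++ [ a ]) ++ M ∷ CP (b ∷ r) ∎
  where open ≡-Reasoning

CP-adjacent : ∀ w a b r →
  CP (w ++ a ∷ b ∷ r) ≡ CP (w ++ [ a ]) ++ peakAt w a (b ∷ r) ++ headPeak a b r ++ CP (b ∷ r)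
CP-adjacent w a b r =
  trans (CP-split w a (b ∷ r)) (cong (λ p → CP (w ++ [ a ]) ++ peakAt w a (b ∷ r) ++ p) (CP-∷∷ a b r))

CP-max-∷ : ∀ {M} σ → All (_≤ M) σ → CP (M ∷ σ) ≡ CP σ
CP-max-∷ []      _           = refl
CP-max-∷ {M} (x ∷ r) (x≤M ∷ _) = trans (CP-∷∷ M x r) (cong (_++ CP (x ∷ r)) (headPeak-≥ˡ r x≤M))

CP-∷ʳ-max : ∀ {M} σ → All (_≤ M) σ → CP (σ ++ [ M ]) ≡ CP σ
CP-∷ʳ-max []              _                 = refl
CP-∷ʳ-max (x ∷ [])        _                 = refl
CP-∷ʳ-max {M} (x ∷ y ∷ []) (_ ∷ y≤M ∷ []) = trans (CP-∷∷∷ x y M []) (cong (_++ []) (peak-≥ʳ x y≤M))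
CP-∷ʳ-max {M} (x ∷ y ∷ z ∷ r) (_ ∷ all) = begin
  CP (x ∷ y ∷ z ∷ r ++ [ M ])       ≡⟨ CP-∷∷∷ x y z (r ++ [ M ]) ⟩
  peak x y z ++ CP (y ∷ z ∷ r ++ [ M ]) ≡⟨ cong (peak x y z ++_) (CP-∷ʳ-max (y ∷ z ∷ r) all) ⟩
  peak x y z ++ CP (y ∷ z ∷ r)      ≡⟨ CP-∷∷∷ x y z r ⟨
  CP (x ∷ y ∷ z ∷ r)                ∎
  where open ≡-Reasoning

∈-CP-tail : ∀ {x} a s → x ∈ CP (a ∷ s) → x ∈ s
∈-CP-tail {x} a (b ∷ r) x∈ =
  [ here ∘′ ∈-headPeak a b r , there ∘′ ∈-CP-tail b r ]′
    (∈-++⁻ (headPeak a b r) (subst (x ∈_) (CP-∷∷ a b r) x∈))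

∈-CP-init : ∀ {x} s a → x ∈ CP (s ++ [ a ]) → x ∈ s
∈-CP-init {x} (y ∷ z ∷ s) a x∈ =
  [ there ∘′ here ∘′ ∈-headPeak y z (s ++ [ a ]) , there ∘′ ∈-CP-init (z ∷ s) a ]′
    (∈-++⁻ (headPeak y z (s ++ [ a ])) (subst (x ∈_) (CP-∷∷ y z (s ++ [ a ])) x∈))

CP-unique : ∀ s → Unique s → Unique (CP s)
CP-unique []          _                = []
CP-unique (_ ∷ [])    _                = []
CP-unique (a ∷ b ∷ r) (_ ∷ u@(b∉r ∷ _)) =
  subst Unique (sym (CP-∷∷ a b r)) (prepend (headPeak-cases a b r) (CP-unique (b ∷ r) u))
  where
  prepend : headPeak a b r ≡ [] ⊎ (headPeak a b r ≡ [ b ] × a < b) →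
            Unique (CP (b ∷ r)) → Unique (headPeak a b r ++ CP (b ∷ r))
  prepend (inj₁ none)         uCP rewrite none   = uCP
  prepend (inj₂ (single , _)) uCP rewrite single =
    All.tabulate (λ x∈ b≡x → All.lookup b∉r (∈-CP-tail b r x∈) b≡x) ∷ uCP

∈-CP : ∀ {x} s → x ∈ CP s → x ∈ s
∈-CP (a ∷ s) x∈ = there (∈-CP-tail a s x∈)

bit : Bool → ℕ
bit b = if b then 1 else 0

-- xS n S is definitionally indicator n (_∈? S).
indicator : ∀ n {P : Pred ℕ 0ℓ} → Decidable P → Vec ℕ n
indicator n P? = tabulate (λ i → bit (does (P? (suc (toℕ i)))))

indicator-cong : ∀ n {P Q : Pred ℕ 0ℓ} (P? : Decidable P) (Q? : Decidable Q) →
  (∀ {x} → x ≤ n → P x → Q x) → (∀ {x} → x ≤ n → Q x → P x) → indicator n P? ≡ indicator n Q?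
indicator-cong n P? Q? P⇒Q Q⇒P = Vec.tabulate-cong λ i →
  cong bit (does-⇔ (mk⇔ (P⇒Q (toℕ<n i)) (Q⇒P (toℕ<n i))) (P? _) (Q? _))

indicator-suc : ∀ n {P : Pred ℕ 0ℓ} (P? : Decidable P) →
  indicator (suc n) P? ≡ indicator n P? ∷ʳ bit (does (P? (suc n)))
indicator-suc zero    P? = refl
indicator-suc (suc n) P? = cong (bit (does (P? 1)) Vec.∷_) (indicator-suc n (λ x → P? (suc x)))

indicator-decrement : ∀ {n} {P : Pred ℕ 0ℓ} (P? : Decidable P) (i : Fin n) →
  updateAt (indicator n P?) i (_∸ 1) ≡ indicator n (λ x → P? x ×-dec ¬? (x ℕ.≟ suc (toℕ i)))
indicator-decrement P? Fin.zero =
  cong₂ Vec._∷_ (trans (drop (P? 1)) (cong bit (sym (∧-zeroʳ _))))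
                (Vec.tabulate-cong λ _ → cong bit (sym (∧-identityʳ _)))
  where
  drop : ∀ {A : Set} (d : Dec A) → bit (does d) ∸ 1 ≡ 0
  drop (yes _) = refl
  drop (no _)  = refl
indicator-decrement P? (Fin.suc i) =
  cong₂ Vec._∷_ (cong bit (sym (∧-identityʳ _))) (indicator-decrement (λ x → P? (suc x)) i)

updateAt-∷ʳ-last : ∀ {A : Set} {n} (v : Vec A n) x (f : A → A) → updateAt (v ∷ʳ x) (fromℕ n) f ≡ v ∷ʳ f x
updateAt-∷ʳ-last Vec.[]       x f = refl
updateAt-∷ʳ-last (y Vec.∷ v) x f = cong (y Vec.∷_) (updateAt-∷ʳ-last v x f)

-- Coefficients of the insertions of n + 1 into one permutation

peakTerm : (n : ℕ) → List ℕ → Term n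
peakTerm n τ = (+ 1 , xS n (CP τ) , length (CP τ))

module Coefficients (n : ℕ) (E : Vec ℕ (suc n)) (K : ℕ) where

  M : ℕ
  M = suc n

  χ : Vec ℕ M → ℕ → ℤ
  χ v j = termCoeff E K (+ 1 , v , j)

  setCoeff : List ℕ → ℤ
  setCoeff Q = χ (xS M Q) (length Q)

  ≤n⇒≢M : ∀ {x} → x ≤ n → x ≢ M
  ≤n⇒≢M x≤n refl = ℕ.<-irrefl refl x≤n

  withTop withoutTop : List ℕ → ℤ
  withTop    Q = χ (xS n Q ∷ʳ 1) (suc (length Q))
  withoutTop Q = χ (xS n Q ∷ʳ 0) (length Q)

  setCoeff-top : ∀ X Y → setCoeff (X ++ M ∷ Y) ≡ withTop (X ++ Y)
  setCoeff-top X Y = cong₂ χ vec (List.length-++-sucʳ X M Y)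
    where
    vec : xS M (X ++ M ∷ Y) ≡ xS n (X ++ Y) ∷ʳ 1
    vec = trans (indicator-suc n (_∈? X ++ M ∷ Y))
      (cong₂ _∷ʳ_ (indicator-cong n (_∈? X ++ M ∷ Y) (_∈? X ++ Y)
                     (λ x≤n x∈ → ∈-++-∷⁻ X Y x∈ (≤n⇒≢M x≤n)) (λ _ → ∈-++-∷⁺ X Y))
                  (cong bit (dec-true (M ∈? X ++ M ∷ Y) (∈-++⁺ʳ X (here refl)))))

  setCoeff-noTop : ∀ Q → M ∉ Q → setCoeff Q ≡ withoutTop Q
  setCoeff-noTop Q M∉Q = cong (λ v → χ v (length Q))
    (trans (indicator-suc n (_∈? Q)) (cong (λ b → xS n Q ∷ʳ bit b) (dec-false (M ∈? Q) M∉Q)))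

  -- For a peak set P with k = |P|: stay, addTop and swapTop a are the coefficients of x^P y^k,
  -- x_{n+1} x^P y^{k+1} and x_{n+1} x^{P∖{a}} y^k; inserting n + 1 next to a lowers addTop by loss a.
  module Peaks (P : List ℕ) where

    e : Vec ℕ n
    e = xS n P

    k : ℕ
    k = length P

    stay addTop : ℤ
    stay   = withoutTop P
    addTop = withTop P

    swapVec : ℕ → Vec ℕ n
    swapVec a = indicator n (λ x → x ∈? P ×-dec ¬? (x ℕ.≟ a))

    swapTop : ℕ → ℤ
    swapTop a = χ (swapVec a ∷ʳ 1) k

    loss : ℕ → ℤ
    loss a = if does (a ∈? P) then addTop - swapTop a else + 0

    loss-∉ : ∀ {a} → a ∉ P → loss a ≡ + 0
    loss-∉ {a} a∉P = cong (λ b → if b then addTop - swapTop a else + 0) (dec-false (a ∈? P) a∉P)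

    loss-∈ : ∀ {a} → a ∈ P → loss a ≡ addTop - swapTop a
    loss-∈ {a} a∈P = cong (λ b → if b then addTop - swapTop a else + 0) (dec-true (a ∈? P) a∈P)

    slotValue : ℕ → ℕ → ℤ
    slotValue a b = addTop - loss a - loss b

    swapTop-value : ∀ X c Y → Unique P → P ≡ X ++ c ∷ Y → withTop (X ++ Y) ≡ swapTop c
    swapTop-value X c Y uP refl = cong₂ (λ v j → χ (v ∷ʳ 1) j) vec (sym (List.length-++-sucʳ X c Y))
      where
      c∉XY = proj₁ (unique-++-∷⁻ X Y uP)
      vec : xS n (X ++ Y) ≡ swapVec c
      vec = indicator-cong n (_∈? X ++ Y) (λ x → x ∈? P ×-dec ¬? (x ℕ.≟ c))
        (λ _ x∈ → ∈-++-∷⁺ X Y x∈ , λ { refl → c∉XY x∈ })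
        (λ _ (x∈ , x≢c) → ∈-++-∷⁻ X Y x∈ x≢c)

    onePeak-value : ∀ X Y c d → Unique P → P ≡ X ++ c ∷ Y → d ∉ X ++ Y → d ≢ c →
      withTop (X ++ Y) ≡ addTop - loss c - loss d
    onePeak-value X Y c d uP P≡ d∉XY d≢c = begin
      withTop (X ++ Y)                             ≡⟨ swapTop-value X c Y uP P≡ ⟩
      swapTop c                                ≡⟨ identity addTop (swapTop c) ⟩
      addTop - (addTop - swapTop c) - + 0      ≡⟨ cong₂ (λ l l′ → addTop - l - l′) (loss-∈ c∈P) (loss-∉ d∉P) ⟨
      addTop - loss c - loss d                 ∎
      where
      open ≡-Reasoning
      identity : ∀ t s → s ≡ t - (t - s) - + 0
      identity = solve-∀
      c∈P : c ∈ P
      c∈P = subst (c ∈_) (sym P≡) (∈-++⁺ʳ X (here refl))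
      d∉P : d ∉ P
      d∉P d∈P = d∉XY (∈-++-∷⁻ X Y (subst (d ∈_) P≡ d∈P) d≢c)

    adjacent-value : ∀ X Y a b α β → P ≡ X ++ α ++ β ++ Y → Unique P →
      a ∉ X ++ Y → b ∉ X ++ Y → a ≢ b →
      α ≡ [] ⊎ (α ≡ [ a ] × b < a) → β ≡ [] ⊎ (β ≡ [ b ] × a < b) →
      withTop (X ++ Y) ≡ slotValue a b
    adjacent-value X Y a b _ _ P≡ uP a∉XY b∉XY a≢b (inj₁ refl) (inj₁ refl) = begin
      withTop (X ++ Y)         ≡⟨ cong withTop P≡ ⟨
      addTop                   ≡⟨ identity addTop ⟩
      addTop - + 0 - + 0       ≡⟨ cong₂ (λ l l′ → addTop - l - l′) (loss-∉ (a∉XY ∘′ subst (a ∈_) P≡))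
                                                                 (loss-∉ (b∉XY ∘′ subst (b ∈_) P≡)) ⟨
      slotValue a b            ∎
      where
      open ≡-Reasoning
      identity : ∀ t → t ≡ t - + 0 - + 0
      identity = solve-∀
    adjacent-value X Y a b _ _ P≡ uP a∉XY b∉XY a≢b (inj₂ (refl , _)) (inj₁ refl) =
      onePeak-value X Y a b uP P≡ b∉XY (a≢b ∘′ sym)
    adjacent-value X Y a b _ _ P≡ uP a∉XY b∉XY a≢b (inj₁ refl) (inj₂ (refl , _)) =
      trans (onePeak-value X Y b a uP P≡ a∉XY a≢b) (exchange addTop (loss b) (loss a))
      where
      exchange : ∀ t x y → t - x - y ≡ t - y - x
      exchange = solve-∀
    adjacent-value X Y a b _ _ P≡ uP a∉XY b∉XY a≢b (inj₂ (_ , b<a)) (inj₂ (_ , a<b)) =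
      ⊥-elim (ℕ.<-asym a<b b<a)

    slot-coeff : ∀ w a b r → P ≡ CP (w ++ a ∷ b ∷ r) → Unique (w ++ a ∷ b ∷ r) → a < M → b < M →
      setCoeff (CP (w ++ a ∷ M ∷ b ∷ r)) ≡ slotValue a b
    slot-coeff w a b r P≡ uσ a<M b<M = begin
      setCoeff (CP (w ++ a ∷ M ∷ b ∷ r))  ≡⟨ cong setCoeff (CP-insert-between w r a<M b<M) ⟩
      setCoeff (X ++ M ∷ Y)                ≡⟨ setCoeff-top X Y ⟩
      withTop (X ++ Y)                         ≡⟨ adjacent-value X Y a b _ _ (trans P≡ (CP-adjacent w a b r))
                                                (subst Unique (sym P≡) (CP-unique _ uσ)) a∉XY b∉XY a≢b
                                                (peakAt-cases w a b r) (headPeak-cases a b r) ⟩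
      slotValue a b                        ∎
      where
      open ≡-Reasoning
      X = CP (w ++ [ a ])
      Y = CP (b ∷ r)
      XY⊆wr : ∀ {x} → x ∈ X ++ Y → x ∈ w ++ r
      XY⊆wr x∈ with ∈-++⁻ X x∈
      ... | inj₁ x∈X = ∈-++⁺ˡ (∈-CP-init w a x∈X)
      ... | inj₂ x∈Y = ∈-++⁺ʳ w (∈-CP-tail b r x∈Y)
      a∉wbr = proj₁ (unique-++-∷⁻ w (b ∷ r) uσ)
      a∉XY : a ∉ X ++ Y
      a∉XY = a∉wbr ∘′ ∈-++-∷⁺ w r ∘′ XY⊆wr
      b∉XY : b ∉ X ++ Y
      b∉XY = proj₁ (unique-++-∷⁻ w r (proj₂ (unique-++-∷⁻ w (b ∷ r) uσ))) ∘′ XY⊆wr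
      a≢b : a ≢ b
      a≢b refl = a∉wbr (∈-++⁺ʳ w (here refl))

    t : Term n
    t = (+ 1 , e , k)

    coeff-doubled : coeff (doubled n [ t ]) E K ≡ + 2 * stay
    coeff-doubled = trans (ℤ.+-identityʳ _) (termCoeff-scalar E K (+ 2) (e ∷ʳ 0) k)

    coeff-xTopTimes : coeff (xTopTimes n [ t ]) E K ≡ + (n ∸ 1) * addTop
    coeff-xTopTimes = begin
      termCoeff E K (+ (n ∸ 1) * + 1 , updateAt (e ∷ʳ 0) (fromℕ n) suc , suc k) + + 0
        ≡⟨ ℤ.+-identityʳ _ ⟩
      termCoeff E K (+ (n ∸ 1) * + 1 , updateAt (e ∷ʳ 0) (fromℕ n) suc , suc k)
        ≡⟨ cong (λ v → termCoeff E K (+ (n ∸ 1) * + 1 , v , suc k)) (updateAt-∷ʳ-last e 0 suc) ⟩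
      termCoeff E K (+ (n ∸ 1) * + 1 , e ∷ʳ 1 , suc k)
        ≡⟨ termCoeff-scalar E K _ (e ∷ʳ 1) (suc k) ⟩
      + (n ∸ 1) * + 1 * addTop
        ≡⟨ cong (_* addTop) (ℤ.*-identityʳ (+ (n ∸ 1))) ⟩
      + (n ∸ 1) * addTop ∎
      where open ≡-Reasoning

    coeff-xTopY²Derivative : coeff (xTopY²Derivative n [ t ]) E K ≡ - (+ 2) * (+ k * addTop)
    coeff-xTopY²Derivative = begin
      termCoeff E K (- (+ 2) * (+ 1 * + k) , updateAt (e ∷ʳ 0) (fromℕ n) suc , suc (suc (k ∸ 1))) + + 0
        ≡⟨ ℤ.+-identityʳ _ ⟩
      termCoeff E K (- (+ 2) * (+ 1 * + k) , updateAt (e ∷ʳ 0) (fromℕ n) suc , suc (suc (k ∸ 1)))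
        ≡⟨ cong (λ v → termCoeff E K (- (+ 2) * (+ 1 * + k) , v , suc (suc (k ∸ 1))))
                (updateAt-∷ʳ-last e 0 suc) ⟩
      termCoeff E K (- (+ 2) * (+ 1 * + k) , e ∷ʳ 1 , suc (suc (k ∸ 1)))
        ≡⟨ derivative k ⟩
      - (+ 2) * (+ k * addTop) ∎
      where
      open ≡-Reasoning
      derivative : ∀ j → termCoeff E K (- (+ 2) * (+ 1 * + j) , e ∷ʳ 1 , suc (suc (j ∸ 1)))
                         ≡ - (+ 2) * (+ j * χ (e ∷ʳ 1) (suc j))
      -- For j = 0 the y-exponent suc (suc (0 ∸ 1)) is junk, but the coefficient vanishes.
      derivative zero    = trans (termCoeff-scalar E K (+ 0) (e ∷ʳ 1) 2) (vanish (χ (e ∷ʳ 1) 2) (χ (e ∷ʳ 1) 1))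
        where
        vanish : ∀ x y → + 0 * x ≡ - (+ 2) * (+ 0 * y)
        vanish = solve-∀
      derivative (suc j) = trans (termCoeff-scalar E K _ (e ∷ʳ 1) (suc (suc j))) (reassoc (+ suc j) _)
        where
        reassoc : ∀ a x → - (+ 2) * (+ 1 * a) * x ≡ - (+ 2) * (a * x)
        reassoc = solve-∀

    contribution : ℕ → ℤ
    contribution a = if does (a ∈? P) then swapTop a else + 0

    derivative-coeff : ∀ i →
      termCoeff E K (+ 2 * (+ 1 * + lookup e i) , updateAt (updateAt e i (_∸ 1) ∷ʳ 0) (fromℕ n) suc , k)
        ≡ + 2 * contribution (suc (toℕ i))
    derivative-coeff i = begin
      termCoeff E K (+ 2 * (+ 1 * + lookup e i) , updateAt (updateAt e i (_∸ 1) ∷ʳ 0) (fromℕ n) suc , k)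
        ≡⟨ cong (λ v → termCoeff E K (+ 2 * (+ 1 * + lookup e i) , v , k))
             (trans (updateAt-∷ʳ-last _ 0 suc) (cong (_∷ʳ 1) (indicator-decrement (_∈? P) i))) ⟩
      termCoeff E K (+ 2 * (+ 1 * + lookup e i) , swapVec (suc (toℕ i)) ∷ʳ 1 , k)
        ≡⟨ termCoeff-scalar E K (+ 2 * (+ 1 * + lookup e i)) (swapVec (suc (toℕ i)) ∷ʳ 1) k ⟩
      + 2 * (+ 1 * + lookup e i) * swapTop (suc (toℕ i))
        ≡⟨ cong (λ m → + 2 * (+ 1 * + m) * swapTop (suc (toℕ i))) (Vec.lookup∘tabulate _ i) ⟩
      + 2 * (+ 1 * + bit (does (suc (toℕ i) ∈? P))) * swapTop (suc (toℕ i))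
        ≡⟨ select (does (suc (toℕ i) ∈? P)) ⟩
      + 2 * contribution (suc (toℕ i)) ∎
      where
      open ≡-Reasoning
      select : ∀ b → + 2 * (+ 1 * + bit b) * swapTop (suc (toℕ i))
                   ≡ + 2 * (if b then swapTop (suc (toℕ i)) else + 0)
      select true  = refl
      select false = trans (ℤ.*-zeroˡ (swapTop (suc (toℕ i)))) (sym (ℤ.*-zeroʳ (+ 2)))

    coeff-xTopDerivatives : Unique P → All (_∈ range n) P →
      coeff (xTopDerivatives n [ t ]) E K ≡ + 2 * ∑ P swapTop
    coeff-xTopDerivatives uP P⊆range = begin
      coeff (xTopDerivatives n [ t ]) E K
        ≡⟨ cong (λ p → coeff (scale (+ 2) (mulX (fromℕ n) (lift p))) E K) sumdX-single ⟩
      coeff (scale (+ 2) (mulX (fromℕ n) (lift (map derivativeTerm (allFin n))))) E K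
        ≡⟨ trans (coeff-map⁴ _ _ _ derivativeTerm (allFin n) E K) (∑-cong (allFin n) derivative-coeff) ⟩
      ∑ (allFin n) (λ i → + 2 * contribution (suc (toℕ i)))
        ≡⟨ ∑-* (allFin n) (+ 2) _ ⟩
      + 2 * ∑ (allFin n) (λ i → contribution (suc (toℕ i)))
        ≡⟨ cong (+ 2 *_) (∑-allFin n contribution) ⟩
      + 2 * ∑ (range n) contribution
        ≡⟨ cong (+ 2 *_) (∑-restrict swapTop (range-unique n) uP (All.lookup P⊆range)) ⟩
      + 2 * ∑ P swapTop ∎
      where
      open ≡-Reasoning
      derivativeTerm : Fin n → Term n
      derivativeTerm i = (+ 1 * + lookup e i , updateAt e i (_∸ 1) , k)
      sumdX-single : sumdX [ t ] ≡ map derivativeTerm (allFin n)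
      sumdX-single = trans (sym (List.concatMap-map [_] derivativeTerm (allFin n))) (List.concatMap-pure _)

    coeff-recurrence : Unique P → All (_∈ range n) P →
      coeff (recurrence n [ t ]) E K ≡ + 2 * stay + + (n ∸ 1) * addTop + + 2 * ∑ P swapTop + - (+ 2) * (+ k * addTop)
    coeff-recurrence uP P⊆range = begin
      coeff (((A ++ B) ++ C) ++ D) E K
        ≡⟨ coeff-++ ((A ++ B) ++ C) D E K ⟩
      coeff ((A ++ B) ++ C) E K + coeff D E K
        ≡⟨ cong (_+ coeff D E K) (coeff-++ (A ++ B) C E K) ⟩
      coeff (A ++ B) E K + coeff C E K + coeff D E K
        ≡⟨ cong (λ x → x + coeff C E K + coeff D E K) (coeff-++ A B E K) ⟩
      coeff A E K + coeff B E K + coeff C E K + coeff D E K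
        ≡⟨ cong₂ _+_ (cong₂ _+_ (cong₂ _+_ coeff-doubled coeff-xTopTimes) (coeff-xTopDerivatives uP P⊆range))
                     coeff-xTopY²Derivative ⟩
      + 2 * stay + + (n ∸ 1) * addTop + + 2 * ∑ P swapTop + - (+ 2) * (+ k * addTop) ∎
      where
      open ≡-Reasoning
      A = doubled n [ t ]
      B = xTopTimes n [ t ]
      C = xTopDerivatives n [ t ]
      D = xTopY²Derivative n [ t ]

  module Insertions (a₀ : ℕ) (s₀ : List ℕ) (σ-perm : IsPerm n (a₀ ∷ s₀)) where

    σ : List ℕ
    σ = a₀ ∷ s₀

    open Peaks (CP σ)

    uσ : Unique σ
    uσ = proj₂ (proj₂ σ-perm)

    σ⊆range : All (_∈ range n) σ
    σ⊆range = proj₁ (proj₂ σ-perm)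

    <M : ∀ {x} → x ∈ σ → x < M
    <M x∈ = s≤s (proj₂ (∈-range⁻ (All.lookup σ⊆range x∈)))

    σ≤M : All (_≤ M) σ
    σ≤M = All.tabulate (ℕ.<⇒≤ ∘′ <M)

    M∉P : M ∉ CP σ
    M∉P M∈ = ℕ.<-irrefl refl (<M (∈-CP σ M∈))

    peakCoeff : List ℕ → ℤ
    peakCoeff τ = setCoeff (CP τ)

    peakCoeff-front : peakCoeff (M ∷ σ) ≡ stay
    peakCoeff-front = trans (cong setCoeff (CP-max-∷ σ σ≤M)) (setCoeff-noTop (CP σ) M∉P)

    peakCoeff-back : peakCoeff (σ ++ [ M ]) ≡ stay
    peakCoeff-back = trans (cong setCoeff (CP-∷ʳ-max σ σ≤M)) (setCoeff-noTop (CP σ) M∉P)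

    ∑-insertions : ∀ w a s → σ ≡ w ++ a ∷ s →
      ∑ (insertions M (a ∷ s)) (λ τ → peakCoeff (w ++ τ))
        ≡ peakCoeff (w ++ M ∷ a ∷ s) + adjacentSum slotValue (a ∷ s) + stay
    ∑-insertions w a [] σ≡ =
      trans (cong (λ x → front + (x + + 0)) back) (shuffle front stay)
      where
      front = peakCoeff (w ++ M ∷ [ a ])
      back : peakCoeff (w ++ a ∷ [ M ]) ≡ stay
      back = trans (cong peakCoeff (trans (sym (List.++-assoc w [ a ] [ M ])) (cong (_++ [ M ]) (sym σ≡))))
                   peakCoeff-back
      shuffle : ∀ x y → x + (y + + 0) ≡ x + + 0 + y
      shuffle = solve-∀
    ∑-insertions w a (b ∷ s) σ≡ = begin
      front + ∑ (map (a ∷_) (insertions M (b ∷ s))) (λ τ → peakCoeff (w ++ τ))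
        ≡⟨ cong (λ x → front + x) shift-prefix ⟩
      front + ∑ (insertions M (b ∷ s)) (λ τ → peakCoeff ((w ++ [ a ]) ++ τ))
        ≡⟨ cong (λ x → front + x) (∑-insertions (w ++ [ a ]) b s σ≡′) ⟩
      front + (peakCoeff ((w ++ [ a ]) ++ M ∷ b ∷ s) + rest + stay)
        ≡⟨ cong (λ x → front + (x + rest + stay)) slot ⟩
      front + (slotValue a b + rest + stay)
        ≡⟨ ℤ.+-assoc front (slotValue a b + rest) stay ⟨
      front + (slotValue a b + rest) + stay ∎
      where
      open ≡-Reasoning
      front = peakCoeff (w ++ M ∷ a ∷ b ∷ s)
      rest  = adjacentSum slotValue (b ∷ s)
      shift-prefix : ∑ (map (a ∷_) (insertions M (b ∷ s))) (λ τ → peakCoeff (w ++ τ))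
                   ≡ ∑ (insertions M (b ∷ s)) (λ τ → peakCoeff ((w ++ [ a ]) ++ τ))
      shift-prefix = trans (∑-map (a ∷_) (insertions M (b ∷ s)) (λ τ → peakCoeff (w ++ τ)))
        (∑-cong (insertions M (b ∷ s)) (λ τ → cong peakCoeff (sym (List.++-assoc w [ a ] τ))))
      σ≡′ : σ ≡ (w ++ [ a ]) ++ b ∷ s
      σ≡′ = trans σ≡ (sym (List.++-assoc w [ a ] (b ∷ s)))
      slot : peakCoeff ((w ++ [ a ]) ++ M ∷ b ∷ s) ≡ slotValue a b
      slot = trans (cong peakCoeff (List.++-assoc w [ a ] (M ∷ b ∷ s)))
        (slot-coeff w a b s (cong CP σ≡) (subst Unique σ≡ uσ)
          (<M (subst (a ∈_) (sym σ≡) (∈-++⁺ʳ w (here refl))))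
          (<M (subst (b ∈_) (sym σ≡) (∈-++⁺ʳ w (there (here refl))))))

    ∑-loss : ∑ σ loss ≡ + k * addTop - ∑ (CP σ) swapTop
    ∑-loss = begin
      ∑ σ loss
        ≡⟨ ∑-restrict (λ x → addTop - swapTop x) uσ (CP-unique σ uσ) (∈-CP σ) ⟩
      ∑ (CP σ) (λ x → addTop - swapTop x)
        ≡⟨ ∑-- (CP σ) (λ _ → addTop) swapTop ⟩
      ∑ (CP σ) (λ _ → addTop) - ∑ (CP σ) swapTop
        ≡⟨ cong (_- ∑ (CP σ) swapTop) (∑-const (CP σ) addTop) ⟩
      + k * addTop - ∑ (CP σ) swapTop ∎
      where open ≡-Reasoning

    first∉P : a₀ ∉ CP σ
    first∉P a₀∈ with uσ
    ... | a₀∉s₀ ∷ _ = All.lookup a₀∉s₀ (∈-CP-tail a₀ s₀ a₀∈) refl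

    last∉P : lastOf a₀ s₀ ∉ CP σ
    last∉P last∈ with lastOf-∷ʳ a₀ s₀
    ... | u , σ≡ =
      proj₁ (unique-++-∷⁻ u [] (subst Unique σ≡ uσ))
            (∈-++⁺ˡ (∈-CP-init u _ (subst (λ τ → _ ∈ CP τ) σ≡ last∈)))

    coeff-insertions : coeff (map (peakTerm M) (insertions M σ)) E K ≡ coeff (recurrence n [ peakTerm n σ ]) E K
    coeff-insertions = begin
      coeff (map (peakTerm M) (insertions M σ)) E K
        ≡⟨ trans (coeff≡∑ (map (peakTerm M) (insertions M σ)) E K)
                 (∑-map (peakTerm M) (insertions M σ) (termCoeff E K)) ⟩
      ∑ (insertions M σ) peakCoeff
        ≡⟨ ∑-insertions [] a₀ s₀ refl ⟩
      peakCoeff (M ∷ σ) + adjacentSum slotValue σ + stay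
        ≡⟨ cong₂ (λ x y → x + y + stay) peakCoeff-front (adjacentSum-telescope addTop loss a₀ s₀) ⟩
      stay + (+ length s₀ * addTop - + 2 * ∑ σ loss + loss a₀ + loss last) + stay
        ≡⟨ cong₂ (λ T l → stay + (+ length s₀ * addTop - + 2 * T + l + loss last) + stay)
                 ∑-loss (loss-∉ first∉P) ⟩
      stay + (+ length s₀ * addTop - + 2 * (+ k * addTop - S) + + 0 + loss last) + stay
        ≡⟨ cong₂ (λ m l → stay + (+ m * addTop - + 2 * (+ k * addTop - S) + + 0 + l) + stay)
                 (cong ℕ.pred (proj₁ σ-perm)) (loss-∉ last∉P) ⟩
      stay + (+ (n ∸ 1) * addTop - + 2 * (+ k * addTop - S) + + 0 + + 0) + stay
        ≡⟨ regroup stay addTop S (+ k) (+ (n ∸ 1)) ⟩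
      + 2 * stay + + (n ∸ 1) * addTop + + 2 * S + - (+ 2) * (+ k * addTop)
        ≡⟨ coeff-recurrence (CP-unique σ uσ) (All.tabulate (All.lookup σ⊆range ∘′ ∈-CP σ)) ⟨
      coeff (recurrence n [ peakTerm n σ ]) E K ∎
      where
      open ≡-Reasoning
      S = ∑ (CP σ) swapTop
      last = lastOf a₀ s₀
      regroup : ∀ s a S k l → s + (l * a - + 2 * (k * a - S) + + 0 + + 0) + s
                            ≡ + 2 * s + l * a + + 2 * S + - (+ 2) * (k * a)
      regroup = solve-∀

coeff-insertions-concat : ∀ m E K σs → All (IsPerm (suc m)) σs →
  coeff (map (peakTerm (suc (suc m))) (concatMap (insertions (suc (suc m))) σs)) E K
    ≡ coeff (recurrence (suc m) (map (peakTerm (suc m)) σs)) E K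
coeff-insertions-concat m E K []             []                = cong (λ p → coeff p E K) (sym (recurrence-[] (suc m)))
coeff-insertions-concat m E K ((a ∷ s) ∷ σs) (σ-perm ∷ σs-perm) = begin
  coeff (map T′ (insertions M (a ∷ s) ++ concatMap (insertions M) σs)) E K
    ≡⟨ cong (λ p → coeff p E K) (List.map-++ T′ (insertions M (a ∷ s)) _) ⟩
  coeff (map T′ (insertions M (a ∷ s)) ++ map T′ (concatMap (insertions M) σs)) E K
    ≡⟨ coeff-++ (map T′ (insertions M (a ∷ s))) _ E K ⟩
  coeff (map T′ (insertions M (a ∷ s))) E K + coeff (map T′ (concatMap (insertions M) σs)) E K
    ≡⟨ cong₂ _+_ (Coefficients.Insertions.coeff-insertions (suc m) E K a s σ-perm)
                 (coeff-insertions-concat m E K σs σs-perm) ⟩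
  coeff (recurrence (suc m) [ T (a ∷ s) ]) E K + coeff (recurrence (suc m) (map T σs)) E K
    ≡⟨ coeff-++ (recurrence (suc m) [ T (a ∷ s) ]) _ E K ⟨
  coeff (recurrence (suc m) [ T (a ∷ s) ] ++ recurrence (suc m) (map T σs)) E K
    ≡⟨ ↭⇒≈P (recurrence-additive (suc m) [ T (a ∷ s) ] (map T σs)) E K ⟨
  coeff (recurrence (suc m) (map T ((a ∷ s) ∷ σs))) E K ∎
  where
  open ≡-Reasoning
  M = suc (suc m)
  T′ = peakTerm M
  T = peakTerm (suc m)
coeff-insertions-concat m E K ([] ∷ σs) ((() , _) ∷ _)

g-recurrence : ∀ n → 1 ≤ n → g (suc n) ≈P recurrence n (g n)
g-recurrence (suc m) _ E K = begin
  coeff (map (peakTerm (suc (suc m))) (perms (suc (suc m)))) E K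
    ≡⟨ ↭⇒≈P (map⁺ (peakTerm (suc (suc m))) (perms-suc-↭ (suc m))) E K ⟩
  coeff (map (peakTerm (suc (suc m))) (concatMap (insertions (suc (suc m))) (perms (suc m)))) E K
    ≡⟨ coeff-insertions-concat m E K (perms (suc m)) (All.tabulate ∈-perms⁻) ⟩
  coeff (recurrence (suc m) (g (suc m))) E K ∎
  where open ≡-Reasoning

-- coeff (g 3) E K computes to the six terms of the permutations of [3].
g₃ : g 3 ≈P const (+ 4) ⊕ scale (+ 2) (mulY (mulX (fromℕ 2) (const (+ 1))))
g₃ E K = trans (count (χ v₀ 0) (χ v₁ 1))
  (sym (cong₂ _+_ (termCoeff-scalar E K (+ 4) v₀ 0) (cong (_+ + 0) (termCoeff-scalar E K (+ 2) v₁ 1))))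
  where
  v₀ v₁ : Vec ℕ 3
  v₀ = 0 Vec.∷ 0 Vec.∷ 0 Vec.∷ Vec.[]
  v₁ = 0 Vec.∷ 0 Vec.∷ 1 Vec.∷ Vec.[]
  χ : Vec ℕ 3 → ℕ → ℤ
  χ v j = termCoeff E K (+ 1 , v , j)
  count : ∀ a b → a + (b + (a + (b + (a + (a + + 0))))) ≡ + 4 * a + (+ 2 * b + + 0)
  count = solve-∀

corollary3p1 : (g 3 ≈P const (+ 4) ⊕ scale (+ 2) (mulY (mulX (fromℕ 2) (const (+ 1)))))
    × (∀ (n : ℕ) → 3 ≤ n →
        g (suc n) ≈P
          scale (+ 2) (lift (g n))
          ⊕ scale (+ (n ∸ 1)) (mulY (mulX (fromℕ n) (lift (g n))))
          ⊕ scale (+ 2) (mulX (fromℕ n) (lift (sumdX (g n))))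
          ⊕ scale (- (+ 2)) (mulX (fromℕ n) (mulY (mulY (lift (dY (g n)))))))
corollary3p1 = g₃ , λ n 3≤n → g-recurrence n (ℕ.≤-trans (s≤s z≤n) 3≤n)
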